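{- There is an absolute constant $c > 0$ such that for any distinct primes $p$ and $q$ and any maps $\alpha, \beta : \mathbb{Z}_{pq} \to \mathbb{Z}_{pq}$, the expression $\alpha(x)\beta(y) + x + y$, as $x,y$ range over $\mathbb{Z}_{pq}$, attains at least $c\min\{p,q\}$ distinct values in $\mathbb{Z}_{pq}$. -}

module Defs where

open import Data.Nat using (ℕ; zero; suc; _+_; _*_; _%_)
open import Data.Nat.Properties using (_≟_)
open import Data.Fin using (Fin; toℕ)
open import Data.List using (List; length; map; concatMap; allFin; deduplicate)

_mod_ : ℕ → ℕ → ℕ
m mod zero    = 0
m mod (suc k) = m % suc k

-- Z_n is represented by Fin n (residues 0..n-1); the value of
-- α(x)β(y) + x + y in Z_n, as a residue in ℕ
expr : (n : ℕ) → (Fin n → Fin n) → (Fin n → Fin n) → Fin n → Fin n → ℕ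
expr n α β x y = (toℕ (α x) * toℕ (β y) + toℕ x + toℕ y) mod n

allValues : (n : ℕ) → (Fin n → Fin n) → (Fin n → Fin n) → List ℕ
allValues n α β = concatMap (λ x → map (λ y → expr n α β x y) (allFin n)) (allFin n)

numValues : (n : ℕ) → (Fin n → Fin n) → (Fin n → Fin n) → ℕ
numValues n α β = length (deduplicate _≟_ (allValues n α β))

-- If α is constant modulo p, then for a fixed y₀ the map x ↦ α(x)β(y₀) + x + y₀ is injective
-- modulo p on 0, …, p − 1, so there are at least p values; likewise for q. Otherwise some
-- difference α(x₁) − α(x₂) is divisible by neither p nor q, hence cancellable modulo pq.
-- Then y ↦ (value at (x₁, y), value at (x₂, y)) is injective: equal pairs give
-- pq ∣ (α(x₁) − α(x₂))(β(y) − β(y′)), so pq ∣ β(y) − β(y′), and then pq ∣ y − y′.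
-- Hence pq ≤ s² for the number s of values, so min(p, q) ≤ s, and c = 1 works.
module Submission where

open import Defs
open import Data.Fin using (Fin; zero; toℕ; inject≤; combine; fromℕ<)
open import Data.Fin.Properties using (toℕ<n; toℕ-injective; toℕ-inject≤; combine-injective; injective⇒≤; all?; ¬∀⟶∃¬)
open import Data.Integer as ℤ using (ℤ; +_; _+_; _-_; _/ℕ_)
open import Data.Integer.DivMod using (a≡a%ℕn+[a/ℕn]*n)
open import Data.Integer.Divisibility.Signed using (_∣_; _∣?_; divides; ∣ᵤ⇒∣; ∣⇒∣ᵤ; ∣-trans; ∣m∣n⇒∣m-n; ∣m∣n⇒∣m+n; ∣m+n∣m⇒∣n; ∣n⇒∣m*n; ∣m⇒∣m*n)
open import Data.Integer.Properties using (+-injective; pos-+; pos-*; abs-*; ∣i∣≡0⇒i≡0; i-j≡0⇒i≡j; [+m]-[+n]≡m⊖n; ∣m⊝n∣≤m⊔n)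
open import Data.Integer.Tactic.RingSolver using (solve-∀)
open import Data.List using (List; length; deduplicate)
open import Data.List.Membership.Propositional using (_∈_; lose)
open import Data.List.Membership.Propositional.Properties using (∈-deduplicate⁺; ∈-concatMap⁺; ∈-map⁺; ∈-allFin)
import Data.List.Membership.Setoid.Properties as SetoidMembership
open import Data.List.Relation.Unary.Any as Any using ()
open import Data.Nat as ℕ using (ℕ; zero; suc; _*_; _≤_; _<_; _⊓_; _⊔_; NonZero)
import Data.Nat.Divisibility as ℕ
open import Data.Nat.DivMod using (_%_)
open import Data.Nat.Primality using (Prime; euclidsLemma; prime⇒irreducible; prime⇒nonZero; ¬prime[1])
open import Data.Nat.Properties as ℕ using (_≟_)
open import Data.Product using (∃-syntax; ∃₂; _×_; _,_)
open import Data.Sum as Sum using (_⊎_; inj₁; inj₂)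
open import Function using (Injective; _∘_)
open import Relation.Nullary using (¬_; yes; no; contradiction)
open import Relation.Binary.PropositionalEquality

private
  variable
    k m n p q r : ℕ

[r+a*c]-[r+b*c]≡[a-b]*c : ∀ r a b c → (r + a ℤ.* c) - (r + b ℤ.* c) ≡ (a - b) ℤ.* c
[r+a*c]-[r+b*c]≡[a-b]*c = solve-∀

mod-≡⇒∣- : ∀ n .{{_ : NonZero n}} {m m′} → m mod n ≡ m′ mod n → + n ∣ + m - + m′
mod-≡⇒∣- n@(suc _) {m} {m′} eq = divides (+ m /ℕ n - + m′ /ℕ n) (begin
  + m - + m′
    ≡⟨ cong₂ _-_ (a≡a%ℕn+[a/ℕn]*n (+ m) n) (a≡a%ℕn+[a/ℕn]*n (+ m′) n) ⟩
  (+ (m % n) + + m /ℕ n ℤ.* + n) - (+ (m′ % n) + + m′ /ℕ n ℤ.* + n)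
    ≡⟨ cong (λ r → (+ r + + m /ℕ n ℤ.* + n) - (+ (m′ % n) + + m′ /ℕ n ℤ.* + n)) eq ⟩
  (+ (m′ % n) + + m /ℕ n ℤ.* + n) - (+ (m′ % n) + + m′ /ℕ n ℤ.* + n)
    ≡⟨ [r+a*c]-[r+b*c]≡[a-b]*c (+ (m′ % n)) (+ m /ℕ n) (+ m′ /ℕ n) (+ n) ⟩
  (+ m /ℕ n - + m′ /ℕ n) ℤ.* + n ∎)
  where open ≡-Reasoning

∣-residues⇒≡ : ∀ {n a b} → a < n → b < n → + n ∣ + a - + b → a ≡ b
∣-residues⇒≡ {n} {a} {b} a<n b<n n∣a-b =
  +-injective (i-j≡0⇒i≡j _ _ (∣i∣≡0⇒i≡0 (multiple-below⇒0 (∣⇒∣ᵤ n∣a-b) distance<n)))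
  where
  distance<n : ℤ.∣ + a - + b ∣ < n
  distance<n = begin-strict
    ℤ.∣ + a - + b ∣ ≡⟨ cong ℤ.∣_∣ ([+m]-[+n]≡m⊖n a b) ⟩
    ℤ.∣ a ℤ.⊖ b ∣   ≤⟨ ∣m⊝n∣≤m⊔n a b ⟩
    a ⊔ b         <⟨ ℕ.⊔-lub a<n b<n ⟩
    n             ∎
    where open ℕ.≤-Reasoning
  multiple-below⇒0 : ∀ {d} → n ℕ.∣ d → d < n → d ≡ 0
  multiple-below⇒0 {zero}  _   _   = refl
  multiple-below⇒0 {suc _} n∣d d<n = contradiction n∣d (ℕ.>⇒∤ d<n)

prime∣*⇒∣⊎∣ : ∀ i j → Prime r → + r ∣ i ℤ.* j → + r ∣ i ⊎ + r ∣ j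
prime∣*⇒∣⊎∣ {r} i j r-prime r∣ij =
  Sum.map ∣ᵤ⇒∣ ∣ᵤ⇒∣ (euclidsLemma ℤ.∣ i ∣ ℤ.∣ j ∣ r-prime (subst (r ℕ.∣_) (abs-* i j) (∣⇒∣ᵤ r∣ij)))

distinct-primes-∣⇒*∣ : Prime p → Prime q → p ≢ q → p ℕ.∣ m → q ℕ.∣ m → p * q ℕ.∣ m
distinct-primes-∣⇒*∣ {p} {q} p-prime q-prime p≢q (ℕ.divides-refl c) q∣cp
  with euclidsLemma c p q-prime q∣cp
... | inj₁ (ℕ.divides-refl e) = ℕ.divides e (trans (ℕ.*-assoc e q p) (cong (e *_) (ℕ.*-comm q p)))
... | inj₂ q∣p with prime⇒irreducible p-prime q∣p
...   | inj₁ refl = contradiction q-prime ¬prime[1]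
...   | inj₂ refl = contradiction refl p≢q

distinct-primes-∤⇒cancellable : Prime p → Prime q → p ≢ q → ∀ i →
  ¬ + p ∣ i → ¬ + q ∣ i → ∀ d → + (p * q) ∣ i ℤ.* d → + (p * q) ∣ d
distinct-primes-∤⇒cancellable {p} {q} p-prime q-prime p≢q i p∤i q∤i d pq∣id =
  ∣ᵤ⇒∣ (distinct-primes-∣⇒*∣ p-prime q-prime p≢q
          (∣⇒∣ᵤ (cancel p-prime p∤i p∣id)) (∣⇒∣ᵤ (cancel q-prime q∤i q∣id)))
  where
  p∣id : + p ∣ i ℤ.* d
  p∣id = ∣-trans (∣ᵤ⇒∣ (ℕ.m∣m*n q)) pq∣id
  q∣id : + q ∣ i ℤ.* d
  q∣id = ∣-trans (∣ᵤ⇒∣ (ℕ.n∣m*n p)) pq∣id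
  cancel : Prime r → ¬ + r ∣ i → + r ∣ i ℤ.* d → + r ∣ d
  cancel r-prime r∤i r∣id with prime∣*⇒∣⊎∣ i d r-prime r∣id
  ... | inj₁ r∣i = contradiction r∣i r∤i
  ... | inj₂ r∣d = r∣d

module _ {a} {A : Set a} (xs : List A) where

  private
    index-injective : ∀ {x y} (x∈xs : x ∈ xs) (y∈xs : y ∈ xs) → Any.index x∈xs ≡ Any.index y∈xs → x ≡ y
    index-injective = SetoidMembership.index-injective (setoid A)

  ∈-injection⇒≤ : (f : Fin m → A) → (∀ i → f i ∈ xs) → Injective _≡_ _≡_ f → m ≤ length xs
  ∈-injection⇒≤ f f∈xs f-injective =
    injective⇒≤ {f = Any.index ∘ f∈xs} (λ eq → f-injective (index-injective (f∈xs _) (f∈xs _) eq))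

  ∈-pair-injection⇒≤ : (f g : Fin m → A) → (∀ i → f i ∈ xs) → (∀ i → g i ∈ xs) →
    (∀ {i j} → f i ≡ f j → g i ≡ g j → i ≡ j) → m ≤ length xs * length xs
  ∈-pair-injection⇒≤ f g f∈xs g∈xs fg-injective =
    injective⇒≤ {f = λ i → combine (Any.index (f∈xs i)) (Any.index (g∈xs i))} λ {i} {j} eq →
    let fi≡fj , gi≡gj = combine-injective _ _ _ _ eq
    in fg-injective (index-injective (f∈xs i) (f∈xs j) fi≡fj) (index-injective (g∈xs i) (g∈xs j) gi≡gj)

[a-c]-[b-c]≡a-b : ∀ a b c → (a - c) - (b - c) ≡ a - b
[a-c]-[b-c]≡a-b = solve-∀

[a-c]-[a-b]≡b-c : ∀ a b c → (a - c) - (a - b) ≡ b - c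
[a-c]-[a-b]≡b-c = solve-∀

[a-b]+[b-c]≡a-c : ∀ a b c → (a - b) + (b - c) ≡ a - c
[a-b]+[b-c]≡a-c = solve-∀

∣-from-base⇒∣-pairwise : ∀ {A : Set} {c} (f : A → ℤ) {x₀} →
  (∀ x → c ∣ f x - f x₀) → ∀ x x′ → c ∣ f x - f x′
∣-from-base⇒∣-pairwise {c = c} f {x₀} c∣ x x′ =
  subst (c ∣_) ([a-c]-[b-c]≡a-b (f x) (f x′) (f x₀)) (∣m∣n⇒∣m-n (c∣ x) (c∣ x′))

uniform-mod-or-separated : (f : Fin m → ℤ) (d e : ℤ) →
  (∀ x x′ → d ∣ f x - f x′) ⊎ (∀ x x′ → e ∣ f x - f x′) ⊎
  ∃₂ λ x x′ → ¬ d ∣ f x - f x′ × ¬ e ∣ f x - f x′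
uniform-mod-or-separated {zero} f d e = inj₁ λ ()
uniform-mod-or-separated {suc m} f d e
  with all? (λ x → d ∣? f x - f zero) | all? (λ x → e ∣? f x - f zero)
... | yes d∣ | _ = inj₁ (∣-from-base⇒∣-pairwise f d∣)
... | no _ | yes e∣ = inj₂ (inj₁ (∣-from-base⇒∣-pairwise f e∣))
... | no d∤ | no e∤
  with ¬∀⟶∃¬ _ _ (λ x → d ∣? f x - f zero) d∤ | ¬∀⟶∃¬ _ _ (λ x → e ∣? f x - f zero) e∤
... | x , d∤x | w , e∤w with d ∣? f w - f zero | e ∣? f x - f zero
...   | no d∤w  | _        = inj₂ (inj₂ (w , zero , d∤w , e∤w))
...   | yes _   | no e∤x   = inj₂ (inj₂ (x , zero , d∤x , e∤x))
...   | yes d∣w | yes e∣x  = inj₂ (inj₂ (w , x , d∤w-x , e∤w-x))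
  where
  d∤w-x : ¬ d ∣ f w - f x
  d∤w-x d∣w-x = d∤x (subst (d ∣_) ([a-c]-[a-b]≡b-c (f w) (f x) (f zero)) (∣m∣n⇒∣m-n d∣w d∣w-x))
  e∤w-x : ¬ e ∣ f w - f x
  e∤w-x e∣w-x = e∤w (subst (e ∣_) ([a-b]+[b-c]≡a-c (f w) (f x) (f zero)) (∣m∣n⇒∣m+n e∣w-x e∣x))

pos-[a*b+x+y] : ∀ a b x y → + (a * b ℕ.+ x ℕ.+ y) ≡ + a ℤ.* + b + + x + + y
pos-[a*b+x+y] a b x y = begin
  + (a * b ℕ.+ x ℕ.+ y)       ≡⟨ pos-+ (a * b ℕ.+ x) y ⟩
  + (a * b ℕ.+ x) + + y       ≡⟨ cong (_+ + y) (pos-+ (a * b) x) ⟩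
  + (a * b) + + x + + y       ≡⟨ cong (λ t → t + + x + + y) (pos-* a b) ⟩
  + a ℤ.* + b + + x + + y     ∎
  where open ≡-Reasoning

[a*b+x+y]-[a*b′+x+y′]≡a*[b-b′]+[y-y′] : ∀ a b b′ x y y′ →
  (a ℤ.* b + x + y) - (a ℤ.* b′ + x + y′) ≡ a ℤ.* (b - b′) + (y - y′)
[a*b+x+y]-[a*b′+x+y′]≡a*[b-b′]+[y-y′] = solve-∀

[a*b+x+y]-[a′*b+x′+y]≡[a-a′]*b+[x-x′] : ∀ a a′ b x x′ y →
  (a ℤ.* b + x + y) - (a′ ℤ.* b + x′ + y) ≡ (a - a′) ℤ.* b + (x - x′)
[a*b+x+y]-[a′*b+x′+y]≡[a-a′]*b+[x-x′] = solve-∀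

[a*d+e]-[a′*d+e]≡[a-a′]*d : ∀ a a′ d e → (a ℤ.* d + e) - (a′ ℤ.* d + e) ≡ (a - a′) ℤ.* d
[a*d+e]-[a′*d+e]≡[a-a′]*d = solve-∀

module Values (n : ℕ) .{{_ : NonZero n}} (α β : Fin n → Fin n) where

  values : List ℕ
  values = deduplicate _≟_ (allValues n α β)

  a b ι : Fin n → ℤ
  a x = + toℕ (α x)
  b y = + toℕ (β y)
  ι x = + toℕ x

  E : Fin n → Fin n → ℤ
  E x y = a x ℤ.* b y + ι x + ι y

  expr-∈-values : ∀ x y → expr n α β x y ∈ values
  expr-∈-values x y =
    ∈-deduplicate⁺ _≟_ (∈-concatMap⁺ _ (lose (∈-allFin x) (∈-map⁺ (expr n α β x) (∈-allFin y))))

  expr-≡⇒∣E- : ∀ {x y x′ y′} → expr n α β x y ≡ expr n α β x′ y′ → + n ∣ E x y - E x′ y′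
  expr-≡⇒∣E- {x} {y} {x′} {y′} eq = subst₂ (λ u v → + n ∣ u - v)
    (pos-[a*b+x+y] (toℕ (α x)) (toℕ (β y)) (toℕ x) (toℕ y))
    (pos-[a*b+x+y] (toℕ (α x′)) (toℕ (β y′)) (toℕ x′) (toℕ y′))
    (mod-≡⇒∣- n eq)

  r≤numValues-of-uniform-mod : ∀ {r} → r ℕ.∣ n → (y₀ : Fin n) → (∀ x x′ → + r ∣ a x - a x′) →
    r ≤ numValues n α β
  r≤numValues-of-uniform-mod {r} r∣n y₀ r∣a =
    ∈-injection⇒≤ values (λ i → expr n α β (embed i) y₀) (λ i → expr-∈-values (embed i) y₀) injective
    where
    r≤n : r ≤ n
    r≤n = ℕ.∣⇒≤ r∣n
    embed : Fin r → Fin n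
    embed i = inject≤ i r≤n
    injective : ∀ {i j} → expr n α β (embed i) y₀ ≡ expr n α β (embed j) y₀ → i ≡ j
    injective {i} {j} eq = toℕ-injective (∣-residues⇒≡ (toℕ<n i) (toℕ<n j) r∣i-j)
      where
      r∣E : + r ∣ (a (embed i) - a (embed j)) ℤ.* b y₀ + (ι (embed i) - ι (embed j))
      r∣E = subst (+ r ∣_) ([a*b+x+y]-[a′*b+x′+y]≡[a-a′]*b+[x-x′]
                    (a (embed i)) (a (embed j)) (b y₀) (ι (embed i)) (ι (embed j)) (ι y₀))
                  (∣-trans (∣ᵤ⇒∣ r∣n) (expr-≡⇒∣E- eq))
      r∣i-j : + r ∣ + toℕ i - + toℕ j
      r∣i-j = subst₂ (λ u v → + r ∣ + u - + v) (toℕ-inject≤ i r≤n) (toℕ-inject≤ j r≤n)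
                (∣m+n∣m⇒∣n r∣E (∣m⇒∣m*n (b y₀) (r∣a (embed i) (embed j))))

  n≤numValues²-of-cancellable : (x₁ x₂ : Fin n) → (∀ d → + n ∣ (a x₁ - a x₂) ℤ.* d → + n ∣ d) →
    n ≤ numValues n α β * numValues n α β
  n≤numValues²-of-cancellable x₁ x₂ cancel =
    ∈-pair-injection⇒≤ values (expr n α β x₁) (expr n α β x₂)
      (expr-∈-values x₁) (expr-∈-values x₂) injective
    where
    injective : ∀ {y y′} → expr n α β x₁ y ≡ expr n α β x₁ y′ →
                expr n α β x₂ y ≡ expr n α β x₂ y′ → y ≡ y′
    injective {y} {y′} eq₁ eq₂ = toℕ-injective (∣-residues⇒≡ (toℕ<n y) (toℕ<n y′) n∣y-y′)
      where
      n∣row : ∀ x → expr n α β x y ≡ expr n α β x y′ → + n ∣ a x ℤ.* (b y - b y′) + (ι y - ι y′)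
      n∣row x eq = subst (+ n ∣_)
        ([a*b+x+y]-[a*b′+x+y′]≡a*[b-b′]+[y-y′] (a x) (b y) (b y′) (ι x) (ι y) (ι y′))
        (expr-≡⇒∣E- eq)
      n∣b-b′ : + n ∣ b y - b y′
      n∣b-b′ = cancel _ (subst (+ n ∣_)
        ([a*d+e]-[a′*d+e]≡[a-a′]*d (a x₁) (a x₂) (b y - b y′) (ι y - ι y′))
        (∣m∣n⇒∣m-n (n∣row x₁ eq₁) (n∣row x₂ eq₂)))
      n∣y-y′ : + n ∣ + toℕ y - + toℕ y′
      n∣y-y′ = ∣m+n∣m⇒∣n (n∣row x₁ eq₁) (∣n⇒∣m*n (a x₁) n∣b-b′)

*≤square⇒⊓≤ : m * n ≤ k * k → m ⊓ n ≤ k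
*≤square⇒⊓≤ {m} {n} mn≤kk = ℕ.≮⇒≥ λ k<m⊓n →
  ℕ.<⇒≱ (ℕ.*-mono-< (ℕ.<-≤-trans k<m⊓n (ℕ.m⊓n≤m m n)) (ℕ.<-≤-trans k<m⊓n (ℕ.m⊓n≤n m n))) mn≤kk

module _ (p-prime : Prime p) (q-prime : Prime q) (p≢q : p ≢ q) (α β : Fin (p * q) → Fin (p * q)) where

  private instance
    p≢0 = prime⇒nonZero p-prime
    q≢0 = prime⇒nonZero q-prime
    pq≢0 = ℕ.m*n≢0 p q

  open Values (p * q) α β

  private
    origin : Fin (p * q)
    origin = fromℕ< (ℕ.>-nonZero⁻¹ (p * q))

  min≤numValues : p ⊓ q ≤ numValues (p * q) α β
  min≤numValues with uniform-mod-or-separated a (+ p) (+ q)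
  ... | inj₁ p∣a = ℕ.≤-trans (ℕ.m⊓n≤m p q) (r≤numValues-of-uniform-mod (ℕ.m∣m*n q) origin p∣a)
  ... | inj₂ (inj₁ q∣a) = ℕ.≤-trans (ℕ.m⊓n≤n p q) (r≤numValues-of-uniform-mod (ℕ.n∣m*n p) origin q∣a)
  ... | inj₂ (inj₂ (x₁ , x₂ , p∤a , q∤a)) = *≤square⇒⊓≤ (n≤numValues²-of-cancellable x₁ x₂
          (distinct-primes-∤⇒cancellable p-prime q-prime p≢q (a x₁ - a x₂) p∤a q∤a))

mainTheorem15 : ∃[ K ] (1 ≤ K × (∀ (p q : ℕ) → Prime p → Prime q → p ≢ q →
                  (α β : Fin (p * q) → Fin (p * q)) →
                  p ⊓ q ≤ K * numValues (p * q) α β))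
mainTheorem15 = 1 , ℕ.≤-refl , λ p q p-prime q-prime p≢q α β →
  subst (p ⊓ q ≤_) (sym (ℕ.*-identityˡ _)) (min≤numValues p-prime q-prime p≢q α β)
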